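{- Let $n\ge 1$ and let $\mathcal{C}$ be the caterpillar tree consisting of the path $0,1,\dots,n$ (edges $\{t,t+1\}$) together with, for each $1\le t\le n-1$, $i_t\ge 0$ pendant vertices attached to vertex $t$, labelled $n+1,\dots,n+s$ with $s=\sum_{t=1}^{n-1}i_t$ so that those attached to $1$ come first, then those attached to $2$, and so on. Let $M$ be the $(2n-1)\times s$ matrix whose $(X_1,X_2)$-entry is the Steiner distance $d_{\mathcal{C}}(X_1\cup X_2)$, with rows $X_1$ running in order over $\{0,1\},\dots,\{0,n\},\{1,n\},\dots,\{n-1,n\}$ and columns $X_2$ over $\{0,n+1\},\dots,\{0,n+s\}$, and let $N$ be the $s\times s$ matrix whose $(X_1,X_2)$-entry is $d_{\mathcal{C}}(X_1\cup X_2)$ with rows and columns running over $\{0,n+1\},\dots,\{0,n+s\}$. Let $L$ be the Laplacian matrix of the path on $2n-1$ vertices $1,\dots,2n-1$. Then \[N+M'LM=(n+2)J-I,\] where $J$ is the $s\times s$ all-ones matrix and $I$ the identity.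
   Context: For a connected graph $G$ and a vertex set $Y$ with $|Y|\ge 2$, the Steiner distance $d_G(Y)$ is the minimum number of edges among all connected subgraphs of $G$ whose vertex set contains $Y$. The Laplacian of a graph has diagonal entries equal to vertex degrees, $-1$ at $(i,j)$ if $i,j$ are adjacent, and $0$ otherwise. $M'$ denotes the transpose. -}

module Defs where

open import Data.Nat as ℕ using (ℕ; zero; suc; _+_; _∸_; _≤_; _<_)
open import Data.Fin as Fin using (Fin; toℕ)
open import Data.Integer as ℤ using (ℤ)
open import Data.List using (List; length)
open import Data.List.Membership.Propositional using (_∈_)
open import Data.List.Relation.Unary.All using (All)
open import Data.List.Relation.Unary.Unique.Propositional using (Unique)
open import Data.Product using (_×_; Σ; _,_)
open import Data.Sum using (_⊎_)
open import Data.Bool using (if_then_else_)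
open import Relation.Nullary using (does)
open import Relation.Binary.PropositionalEquality using (_≡_)

-- Generic finite simple graphs on vertex set {0,…,V-1} ⊆ ℕ,
-- given by a (symmetric) adjacency relation Adj.

record Subgraph (V : ℕ) (Adj : ℕ → ℕ → Set) : Set where
  field
    verts     : List ℕ
    edges     : List (ℕ × ℕ)
    verts<V   : All (_< V) verts
    edgesUniq : Unique edges
    edgeOK    : ∀ {u v} → (u , v) ∈ edges → u < v × Adj u v × u ∈ verts × v ∈ verts

data Reach (F : List (ℕ × ℕ)) : ℕ → ℕ → Set where
  here : ∀ {u} → Reach F u u
  step : ∀ {u w v} → ((u , w) ∈ F ⊎ (w , u) ∈ F) → Reach F w v → Reach F u v

Connected : ∀ {V Adj} → Subgraph V Adj → Set
Connected H = ∀ {u v} → u ∈ Subgraph.verts H → v ∈ Subgraph.verts H →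
              Reach (Subgraph.edges H) u v

ConnContaining : ∀ {V Adj} → List ℕ → Subgraph V Adj → Set
ConnContaining Y H = Connected H × (∀ {y} → y ∈ Y → y ∈ Subgraph.verts H)

numEdges : ∀ {V Adj} → Subgraph V Adj → ℕ
numEdges H = length (Subgraph.edges H)

IsSteinerDistance : (V : ℕ) (Adj : ℕ → ℕ → Set) → List ℕ → ℕ → Set
IsSteinerDistance V Adj Y d =
  Σ (Subgraph V Adj) (λ H → ConnContaining Y H × numEdges H ≡ d)
  × (∀ (H : Subgraph V Adj) → ConnContaining Y H → d ≤ numEdges H)

-- The caterpillar. i t = number of pendant vertices at spine vertex t
-- (only 1 ≤ t ≤ n-1 is used).

prefix : (ℕ → ℕ) → ℕ → ℕ
prefix i zero    = 0
prefix i (suc t) = prefix i t + i (suc t)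

numPendants : ℕ → (ℕ → ℕ) → ℕ
numPendants n i = prefix i (n ∸ 1)

catV : ℕ → (ℕ → ℕ) → ℕ
catV n i = suc n + numPendants n i

PendantAt : ℕ → (ℕ → ℕ) → ℕ → ℕ → Set
PendantAt n i t v = 1 ≤ t × t ≤ n ∸ 1 × n + prefix i (t ∸ 1) < v × v ≤ n + prefix i t

CatEdge : ℕ → (ℕ → ℕ) → ℕ → ℕ → Set
CatEdge n i u v = (suc u ≡ v × v ≤ n) ⊎ PendantAt n i u v

CatAdj : ℕ → (ℕ → ℕ) → ℕ → ℕ → Set
CatAdj n i u v = CatEdge n i u v ⊎ CatEdge n i v u

Matrix : ℕ → ℕ → Set
Matrix r c = Fin r → Fin c → ℤ

sumFin : (m : ℕ) → (Fin m → ℤ) → ℤ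
sumFin zero    f = ℤ.0ℤ
sumFin (suc m) f = f Fin.zero ℤ.+ sumFin m (λ k → f (Fin.suc k))

_⊗_ : ∀ {a b c} → Matrix a b → Matrix b c → Matrix a c
_⊗_ {b = b} A B x z = sumFin b (λ y → A x y ℤ.* B y z)

transpose : ∀ {a b} → Matrix a b → Matrix b a
transpose A x y = A y x

_⊕_ : ∀ {a b} → Matrix a b → Matrix a b → Matrix a b
(A ⊕ B) x y = A x y ℤ.+ B x y

Iₘ : (m : ℕ) → Matrix m m
Iₘ m x y = if does (x Fin.≟ y) then ℤ.1ℤ else ℤ.0ℤ

Jₘ : (m : ℕ) → Matrix m m
Jₘ m x y = ℤ.1ℤ

pathAdj : (m : ℕ) → Matrix m m
pathAdj m x y =
  if does (suc (toℕ x) ℕ.≟ toℕ y) then ℤ.1ℤ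
  else if does (suc (toℕ y) ℕ.≟ toℕ x) then ℤ.1ℤ else ℤ.0ℤ

laplacian : (m : ℕ) → Matrix m m → Matrix m m
laplacian m A x y =
  if does (x Fin.≟ y) then sumFin m (λ z → A x z) else ℤ.- A x y

pathLaplacian : (m : ℕ) → Matrix m m
pathLaplacian m = laplacian m (pathAdj m)

-- rows r = 0,…,2n-2 : {0,1},…,{0,n},{1,n},…,{n-1,n}
rowSet : (n : ℕ) → Fin (n + (n ∸ 1)) → List ℕ
rowSet n r with toℕ r ℕ.<? n
... | Relation.Nullary.yes _ = 0 Data.List.∷ suc (toℕ r) Data.List.∷ Data.List.[]
... | Relation.Nullary.no  _ = suc (toℕ r ∸ n) Data.List.∷ n Data.List.∷ Data.List.[]

colSet : (n : ℕ) → ∀ {s} → Fin s → List ℕ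
colSet n k = 0 Data.List.∷ (n + suc (toℕ k)) Data.List.∷ Data.List.[]

-- M and N, built from a Steiner-distance function sd (applied to X₁ ∪ X₂)
matM : (n : ℕ) (i : ℕ → ℕ) (sd : List ℕ → ℕ) →
       Matrix (n + (n ∸ 1)) (numPendants n i)
matM n i sd r k = ℤ.+ sd (rowSet n r Data.List.++ colSet n k)

matN : (n : ℕ) (i : ℕ → ℕ) (sd : List ℕ → ℕ) →
       Matrix (numPendants n i) (numPendants n i)
matN n i sd k l = ℤ.+ sd (colSet n k Data.List.++ colSet n l)

{-# OPTIONS --safe #-}
-- Let t k be the spine vertex carrying the pendant n + 1 + k. A connected subgraph containing
-- 0 and a vertex set Y must contain every spine edge {x, x + 1} beyond which Y has a vertex,
-- and the pendant edge of every pendant in Y (a cut argument), while the spine path together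
-- with these pendant edges is connected. Hence N k l = max (t k) (t l) + 2 for k ≠ l,
-- N k k = t k + 1, and column k of M is x r = max (min (r + 1) n) (t k) + 1.
-- For the path Laplacian, summation by parts gives u′ L v = Σ_c (Δu)_c (Δv)_c with
-- (Δu)_c = u (c + 1) - u c, and the Δ of column k is the indicator of t k ≤ c + 1 < n.
-- So (M′LM) k l counts the c with max (t k) (t l) ≤ c + 1 < n, that is n - max (t k) (t l),
-- and N + M′LM has n + 2 off the diagonal and n + 1 on it.
module Submission where

open import Defs
open import Data.Nat using (ℕ; zero; suc; pred; >-nonZero; _≤_; _<_; _+_; _∸_; _⊔_; _⊓_; _≟_; _<?_; _≤?_; s≤s; z≤n; z<s)
open import Data.Nat.Properties
open import Data.Integer using (ℤ; +_; 0ℤ; 1ℤ; -_; _*_; _-_) renaming (_+_ to _+ℤ_)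
import Data.Integer.Properties as ℤ
open import Data.Integer.Tactic.RingSolver using (solve-∀)
open import Data.Bool using (if_then_else_)
open import Data.Fin as Fin using (Fin; toℕ)
open import Data.Fin.Properties using (toℕ-injective; toℕ<n)
open import Data.List using (List; []; _∷_; _++_; length; map; upTo)
open import Data.List.Properties using (length-++)
open import Data.List.Membership.Propositional using (_∈_)
open import Data.List.Membership.Propositional.Properties
open import Data.List.Relation.Unary.All as All using (All; []; _∷_)
import Data.List.Relation.Unary.All.Properties as All
open import Data.List.Relation.Unary.AllPairs as AllPairs using (AllPairs; []; _∷_)
import Data.List.Relation.Unary.AllPairs.Properties as AllPairs
open import Data.List.Relation.Unary.Any using (here; there)
open import Data.List.Relation.Unary.Unique.Propositional using (Unique)
open import Data.Product using (_×_; ∃; _,_; proj₁; proj₂)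
open import Data.Sum using (_⊎_; inj₁; inj₂)
open import Function using (_∘_)
open import Relation.Nullary using (Dec; yes; no; does; ¬_; contradiction)
open import Relation.Nullary.Decidable using (_⊎-dec_; _×-dec_)
open import Relation.Binary using (tri<; tri≈; tri>)
open import Relation.Binary.PropositionalEquality
open ≡-Reasoning

𝟙 : ∀ {p} {P : Set p} → Dec P → ℤ
𝟙 d = if does d then 1ℤ else 0ℤ

𝟙-yes : ∀ {p} {P : Set p} (d : Dec P) → P → 𝟙 d ≡ 1ℤ
𝟙-yes (yes _) _  = refl
𝟙-yes (no ¬p) p = contradiction p ¬p

𝟙-no : ∀ {p} {P : Set p} (d : Dec P) → ¬ P → 𝟙 d ≡ 0ℤ
𝟙-no (yes p) ¬p = contradiction p ¬p
𝟙-no (no _)  _  = refl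

𝟙-cong : ∀ {p q} {P : Set p} {Q : Set q} (d : Dec P) (e : Dec Q) → (P → Q) → (Q → P) → 𝟙 d ≡ 𝟙 e
𝟙-cong (yes p) e to from = sym (𝟙-yes e (to p))
𝟙-cong (no ¬p) e to from = sym (𝟙-no e (¬p ∘ from))

𝟙-× : ∀ {p q} {P : Set p} {Q : Set q} (d : Dec P) (e : Dec Q) → 𝟙 (d ×-dec e) ≡ 𝟙 d * 𝟙 e
𝟙-× (yes _) (yes _) = refl
𝟙-× (yes _) (no _)  = refl
𝟙-× (no _)  _       = refl

𝟙-≟-sym : ∀ a b → 𝟙 (a ≟ b) ≡ 𝟙 (b ≟ a)
𝟙-≟-sym a b = 𝟙-cong (a ≟ b) (b ≟ a) sym sym

if-𝟙 : ∀ {p q} {P : Set p} {Q : Set q} (d : Dec P) (e : Dec Q) → (P → ¬ Q) →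
       (if does d then 1ℤ else 𝟙 e) ≡ 𝟙 d +ℤ 𝟙 e
if-𝟙 (yes p) (yes q) p⇒¬q = contradiction q (p⇒¬q p)
if-𝟙 (yes _) (no _)  _    = refl
if-𝟙 (no _)  (yes _) _    = refl
if-𝟙 (no _)  (no _)  _    = refl

∑ : ℕ → (ℕ → ℤ) → ℤ
∑ zero    f = 0ℤ
∑ (suc m) f = f 0 +ℤ ∑ m (f ∘ suc)

sumFin≡∑ : ∀ m {f : Fin m → ℤ} {F : ℕ → ℤ} → (∀ x → f x ≡ F (toℕ x)) → sumFin m f ≡ ∑ m F
sumFin≡∑ zero    eq = refl
sumFin≡∑ (suc m) eq = cong₂ _+ℤ_ (eq Fin.zero) (sumFin≡∑ m (eq ∘ Fin.suc))

∑-cong : ∀ m {f g : ℕ → ℤ} → (∀ {r} → r < m → f r ≡ g r) → ∑ m f ≡ ∑ m g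
∑-cong zero    eq = refl
∑-cong (suc m) eq = cong₂ _+ℤ_ (eq (s≤s z≤n)) (∑-cong m (eq ∘ s≤s))

∑-distrib-+ : ∀ m (f g : ℕ → ℤ) → ∑ m (λ r → f r +ℤ g r) ≡ ∑ m f +ℤ ∑ m g
∑-distrib-+ zero    f g = refl
∑-distrib-+ (suc m) f g = trans (cong (f 0 +ℤ g 0 +ℤ_) (∑-distrib-+ m (f ∘ suc) (g ∘ suc)))
                                (swap (f 0) (g 0) (∑ m (f ∘ suc)) (∑ m (g ∘ suc)))
  where
    swap : ∀ a b c d → a +ℤ b +ℤ (c +ℤ d) ≡ a +ℤ c +ℤ (b +ℤ d)
    swap = solve-∀

∑-distrib-minus : ∀ m (f g : ℕ → ℤ) → ∑ m (λ r → f r - g r) ≡ ∑ m f - ∑ m g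
∑-distrib-minus zero    f g = refl
∑-distrib-minus (suc m) f g = trans (cong (f 0 - g 0 +ℤ_) (∑-distrib-minus m (f ∘ suc) (g ∘ suc)))
                                    (swap (f 0) (g 0) (∑ m (f ∘ suc)) (∑ m (g ∘ suc)))
  where
    swap : ∀ a b c d → a - b +ℤ (c - d) ≡ a +ℤ c - (b +ℤ d)
    swap = solve-∀

∑-last : ∀ m (f : ℕ → ℤ) → ∑ (suc m) f ≡ ∑ m f +ℤ f m
∑-last zero    f = ℤ.+-comm (f 0) 0ℤ
∑-last (suc m) f = trans (cong (f 0 +ℤ_) (∑-last m (f ∘ suc))) (sym (ℤ.+-assoc (f 0) _ _))

∑-zero : ∀ m → ∑ m (λ _ → 0ℤ) ≡ 0ℤ
∑-zero zero    = refl
∑-zero (suc m) = trans (ℤ.+-identityˡ _) (∑-zero m)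

-- does (suc a ≟ suc r) and does (suc a <? suc m) compute to does (a ≟ r) and does (a <? m),
-- so the recursion needs no rewriting.
∑-select : ∀ m a (f : ℕ → ℤ) → ∑ m (λ r → 𝟙 (a ≟ r) * f r) ≡ 𝟙 (a <? m) * f a
∑-select zero    a       f = refl
∑-select (suc m) zero    f = begin
  1ℤ * f 0 +ℤ ∑ m (λ r → 0ℤ * f (suc r))
    ≡⟨ cong (1ℤ * f 0 +ℤ_) (trans (∑-cong m λ {r} _ → ℤ.*-zeroˡ (f (suc r))) (∑-zero m)) ⟩
  1ℤ * f 0 +ℤ 0ℤ
    ≡⟨ ℤ.+-identityʳ _ ⟩
  1ℤ * f 0
    ∎
∑-select (suc m) (suc a) f = begin
  0ℤ * f 0 +ℤ ∑ m (λ r → 𝟙 (a ≟ r) * f (suc r))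
    ≡⟨ cong₂ _+ℤ_ (ℤ.*-zeroˡ (f 0)) (∑-select m a (f ∘ suc)) ⟩
  0ℤ +ℤ 𝟙 (a <? m) * f (suc a)
    ≡⟨ ℤ.+-identityˡ (𝟙 (a <? m) * f (suc a)) ⟩
  𝟙 (a <? m) * f (suc a)
    ∎

∑-select-pred : ∀ m {c} (f : ℕ → ℤ) → c < m →
                ∑ m (λ r → 𝟙 (suc r ≟ c) * f r) ≡ 𝟙 (0 <? c) * f (pred c)
∑-select-pred m {zero} f _ = begin
  ∑ m (λ r → 0ℤ * f r)  ≡⟨ ∑-cong m (λ {r} _ → ℤ.*-zeroˡ (f r)) ⟩
  ∑ m (λ _ → 0ℤ)        ≡⟨ ∑-zero m ⟩
  0ℤ                    ≡⟨ ℤ.*-zeroˡ (f 0) ⟨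
  0ℤ * f 0              ∎
∑-select-pred m {suc c} f c<m = begin
  ∑ m (λ r → 𝟙 (r ≟ c) * f r)  ≡⟨ ∑-cong m (λ {r} _ → cong (_* f r) (𝟙-≟-sym r c)) ⟩
  ∑ m (λ r → 𝟙 (c ≟ r) * f r)  ≡⟨ ∑-select m c f ⟩
  𝟙 (c <? m) * f c             ≡⟨ cong (_* f c) (𝟙-yes (c <? m) (<⇒≤ c<m)) ⟩
  1ℤ * f c                     ∎

∑-dropFirst : ∀ m (f : ℕ → ℤ) → ∑ (suc m) (λ c → 𝟙 (0 <? c) * f c) ≡ ∑ m (f ∘ suc)
∑-dropFirst m f = begin
  0ℤ * f 0 +ℤ ∑ m (λ c → 1ℤ * f (suc c))
    ≡⟨ cong₂ _+ℤ_ (ℤ.*-zeroˡ (f 0)) (∑-cong m (λ {c} _ → ℤ.*-identityˡ (f (suc c)))) ⟩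
  0ℤ +ℤ ∑ m (f ∘ suc)
    ≡⟨ ℤ.+-identityˡ _ ⟩
  ∑ m (f ∘ suc)
    ∎

∑-dropLast : ∀ m (f : ℕ → ℤ) → ∑ (suc m) (λ c → 𝟙 (suc c <? suc m) * f c) ≡ ∑ m f
∑-dropLast m f = begin
  ∑ (suc m) g        ≡⟨ ∑-last m g ⟩
  ∑ m g +ℤ g m       ≡⟨ cong₂ _+ℤ_ (∑-cong m below) (cong (_* f m) (𝟙-no (suc m <? suc m) (n≮n (suc m)))) ⟩
  ∑ m f +ℤ 0ℤ * f m  ≡⟨ cong (∑ m f +ℤ_) (ℤ.*-zeroˡ (f m)) ⟩
  ∑ m f +ℤ 0ℤ        ≡⟨ ℤ.+-identityʳ _ ⟩
  ∑ m f              ∎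
  where
    g : ℕ → ℤ
    g c = 𝟙 (suc c <? suc m) * f c
    below : ∀ {c} → c < m → g c ≡ f c
    below {c} c<m = trans (cong (_* f c) (𝟙-yes (suc c <? suc m) (s≤s c<m))) (ℤ.*-identityˡ (f c))

Δ : (ℕ → ℤ) → ℕ → ℤ
Δ x c = x (suc c) - x c

∑-Δ : ∀ m (z : ℕ → ℤ) → ∑ m (Δ z) ≡ z m - z 0
∑-Δ zero    z = sym (ℤ.+-inverseʳ (z 0))
∑-Δ (suc m) z = trans (cong (Δ z 0 +ℤ_) (∑-Δ m (z ∘ suc))) (chain (z 0) (z 1) (z (suc m)))
  where
    chain : ∀ a b c → b - a +ℤ (c - b) ≡ c - a
    chain = solve-∀

pathAdjℕ : ℕ → ℕ → ℤ
pathAdjℕ r c = 𝟙 (suc r ≟ c) +ℤ 𝟙 (suc c ≟ r)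

pathDegree : ℕ → ℕ → ℤ
pathDegree m c = 𝟙 (suc c <? m) +ℤ 𝟙 (0 <? c)

pathLaplacianℕ : ℕ → ℕ → ℕ → ℤ
pathLaplacianℕ m r c = 𝟙 (c ≟ r) * pathDegree m c - pathAdjℕ r c

pathAdj≡pathAdjℕ : ∀ m (x y : Fin m) → pathAdj m x y ≡ pathAdjℕ (toℕ x) (toℕ y)
pathAdj≡pathAdjℕ m x y = if-𝟙 (suc (toℕ x) ≟ toℕ y) (suc (toℕ y) ≟ toℕ x)
  (λ x<y y<x → <⇒≯ (≤-reflexive x<y) (≤-reflexive y<x))

∑-pathAdjℕ : ∀ m {c} → c < m → ∑ m (pathAdjℕ c) ≡ pathDegree m c
∑-pathAdjℕ m {c} c<m = begin
  ∑ m (pathAdjℕ c)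
    ≡⟨ ∑-cong m (λ {r} _ → sym (cong₂ _+ℤ_ (ℤ.*-identityʳ (𝟙 (suc c ≟ r)))
                                           (ℤ.*-identityʳ (𝟙 (suc r ≟ c))))) ⟩
  ∑ m (λ r → 𝟙 (suc c ≟ r) * 1ℤ +ℤ 𝟙 (suc r ≟ c) * 1ℤ)
    ≡⟨ ∑-distrib-+ m _ _ ⟩
  ∑ m (λ r → 𝟙 (suc c ≟ r) * 1ℤ) +ℤ ∑ m (λ r → 𝟙 (suc r ≟ c) * 1ℤ)
    ≡⟨ cong₂ _+ℤ_ (∑-select m (suc c) _) (∑-select-pred m _ c<m) ⟩
  𝟙 (suc c <? m) * 1ℤ +ℤ 𝟙 (0 <? c) * 1ℤ
    ≡⟨ cong₂ _+ℤ_ (ℤ.*-identityʳ (𝟙 (suc c <? m))) (ℤ.*-identityʳ (𝟙 (0 <? c))) ⟩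
  pathDegree m c
    ∎

pathLaplacian≡pathLaplacianℕ : ∀ m (x y : Fin m) → pathLaplacian m x y ≡ pathLaplacianℕ m (toℕ x) (toℕ y)
pathLaplacian≡pathLaplacianℕ m x y with x Fin.≟ y
... | yes refl = begin
  sumFin m (pathAdj m x)
    ≡⟨ sumFin≡∑ m (pathAdj≡pathAdjℕ m x) ⟩
  ∑ m (pathAdjℕ c)
    ≡⟨ ∑-pathAdjℕ m (toℕ<n x) ⟩
  pathDegree m c
    ≡⟨ simplify (pathDegree m c) ⟨
  1ℤ * pathDegree m c - (0ℤ +ℤ 0ℤ)
    ≡⟨ cong₂ (λ a b → a * pathDegree m c - b) (𝟙-yes (c ≟ c) refl) (cong₂ _+ℤ_ no-loop no-loop) ⟨
  pathLaplacianℕ m c c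
    ∎
  where
    c : ℕ
    c = toℕ x
    no-loop : 𝟙 (suc c ≟ c) ≡ 0ℤ
    no-loop = 𝟙-no (suc c ≟ c) 1+n≢n
    simplify : ∀ d → 1ℤ * d - (0ℤ +ℤ 0ℤ) ≡ d
    simplify = solve-∀
... | no x≢y = begin
  - pathAdj m x y                  ≡⟨ cong -_ (pathAdj≡pathAdjℕ m x y) ⟩
  - pathAdjℕ r c                   ≡⟨ simplify (pathDegree m c) (pathAdjℕ r c) ⟩
  0ℤ * pathDegree m c - pathAdjℕ r c
    ≡⟨ cong (λ a → a * pathDegree m c - pathAdjℕ r c) (𝟙-no (c ≟ r) (x≢y ∘ sym ∘ toℕ-injective)) ⟨
  pathLaplacianℕ m r c             ∎
  where
    r c : ℕ
    r = toℕ x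
    c = toℕ y
    simplify : ∀ d a → - a ≡ 0ℤ * d - a
    simplify = solve-∀

pathLaplacianℕ-column : ∀ m (x : ℕ → ℤ) {c} → c < m →
  ∑ m (λ r → x r * pathLaplacianℕ m r c) ≡ 𝟙 (0 <? c) * (x c - x (pred c)) - 𝟙 (suc c <? m) * Δ x c
pathLaplacianℕ-column m x {c} c<m = begin
  ∑ m (λ r → x r * pathLaplacianℕ m r c)
    ≡⟨ ∑-cong m (λ {r} _ → expand (x r) (𝟙 (c ≟ r)) d (𝟙 (suc r ≟ c)) (𝟙 (suc c ≟ r))) ⟩
  ∑ m (λ r → 𝟙 (c ≟ r) * (x r * d) - (𝟙 (suc r ≟ c) * x r +ℤ 𝟙 (suc c ≟ r) * x r))
    ≡⟨ ∑-distrib-minus m _ _ ⟩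
  ∑ m (λ r → 𝟙 (c ≟ r) * (x r * d)) - ∑ m (λ r → 𝟙 (suc r ≟ c) * x r +ℤ 𝟙 (suc c ≟ r) * x r)
    ≡⟨ cong₂ _-_ (∑-select m c (λ r → x r * d)) (∑-distrib-+ m _ _) ⟩
  𝟙 (c <? m) * (x c * d) - (∑ m (λ r → 𝟙 (suc r ≟ c) * x r) +ℤ ∑ m (λ r → 𝟙 (suc c ≟ r) * x r))
    ≡⟨ cong₂ _-_ (cong (_* (x c * d)) (𝟙-yes (c <? m) c<m))
                 (cong₂ _+ℤ_ (∑-select-pred m x c<m) (∑-select m (suc c) x)) ⟩
  1ℤ * (x c * d) - (𝟙 (0 <? c) * x (pred c) +ℤ 𝟙 (suc c <? m) * x (suc c))
    ≡⟨ collect (𝟙 (0 <? c)) (𝟙 (suc c <? m)) (x (pred c)) (x (suc c)) (x c) ⟩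
  𝟙 (0 <? c) * (x c - x (pred c)) - 𝟙 (suc c <? m) * Δ x c
    ∎
  where
    d : ℤ
    d = pathDegree m c
    expand : ∀ y e d a b → y * (e * d - (a +ℤ b)) ≡ e * (y * d) - (a * y +ℤ b * y)
    expand = solve-∀
    collect : ∀ a b u v w → 1ℤ * (w * (b +ℤ a)) - (a * u +ℤ b * v) ≡ a * (w - u) - b * (v - w)
    collect = solve-∀

-- Summation by parts: the Laplacian of the path is the Gram matrix of its edge differences.
pathLaplacianℕ-bilinear : ∀ m (x y : ℕ → ℤ) →
  ∑ m (λ c → ∑ m (λ r → x r * pathLaplacianℕ m r c) * y c) ≡ ∑ (pred m) (λ c → Δ x c * Δ y c)
pathLaplacianℕ-bilinear zero    x y = refl
pathLaplacianℕ-bilinear (suc m) x y = begin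
  ∑ (suc m) (λ c → ∑ (suc m) (λ r → x r * pathLaplacianℕ (suc m) r c) * y c)
    ≡⟨ ∑-cong (suc m) (λ {c} c<m → cong (_* y c) (pathLaplacianℕ-column (suc m) x c<m)) ⟩
  ∑ (suc m) (λ c → (𝟙 (0 <? c) * back c - 𝟙 (suc c <? suc m) * Δ x c) * y c)
    ≡⟨ ∑-cong (suc m) (λ {c} _ → distrib (𝟙 (0 <? c)) (back c) (𝟙 (suc c <? suc m)) (Δ x c) (y c)) ⟩
  ∑ (suc m) (λ c → 𝟙 (0 <? c) * (back c * y c) - 𝟙 (suc c <? suc m) * (Δ x c * y c))
    ≡⟨ ∑-distrib-minus (suc m) (λ c → 𝟙 (0 <? c) * (back c * y c))
                               (λ c → 𝟙 (suc c <? suc m) * (Δ x c * y c)) ⟩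
  ∑ (suc m) (λ c → 𝟙 (0 <? c) * (back c * y c)) - ∑ (suc m) (λ c → 𝟙 (suc c <? suc m) * (Δ x c * y c))
    ≡⟨ cong₂ _-_ (∑-dropFirst m (λ c → back c * y c)) (∑-dropLast m (λ c → Δ x c * y c)) ⟩
  ∑ m (λ c → Δ x c * y (suc c)) - ∑ m (λ c → Δ x c * y c)
    ≡⟨ ∑-distrib-minus m (λ c → Δ x c * y (suc c)) (λ c → Δ x c * y c) ⟨
  ∑ m (λ c → Δ x c * y (suc c) - Δ x c * y c)
    ≡⟨ ∑-cong m (λ {c} _ → factor (Δ x c) (y (suc c)) (y c)) ⟩
  ∑ m (λ c → Δ x c * Δ y c)
    ∎
  where
    back : ℕ → ℤ
    back c = x c - x (pred c)
    distrib : ∀ a u b v w → (a * u - b * v) * w ≡ a * (u * w) - b * (v * w)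
    distrib = solve-∀
    factor : ∀ a u v → a * u - a * v ≡ a * (u - v)
    factor = solve-∀

pathLaplacian-gram : ∀ {s} m (A : Matrix m s) (x : Fin s → ℕ → ℤ) → (∀ r k → A r k ≡ x k (toℕ r)) →
  ∀ k l → ((transpose A ⊗ pathLaplacian m) ⊗ A) k l ≡ ∑ (pred m) (λ c → Δ (x k) c * Δ (x l) c)
pathLaplacian-gram m A x A≡x k l = begin
  ((transpose A ⊗ pathLaplacian m) ⊗ A) k l
    ≡⟨ sumFin≡∑ m (λ c → cong₂ _*_ (sumFin≡∑ m (λ r → cong₂ _*_ (A≡x r k) (L≡ r c))) (A≡x c l)) ⟩
  ∑ m (λ c → ∑ m (λ r → x k r * pathLaplacianℕ m r c) * x l c)
    ≡⟨ pathLaplacianℕ-bilinear m (x k) (x l) ⟩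
  ∑ (pred m) (λ c → Δ (x k) c * Δ (x l) c)
    ∎
  where
    L≡ : ∀ r c → pathLaplacian m r c ≡ pathLaplacianℕ m (toℕ r) (toℕ c)
    L≡ = pathLaplacian≡pathLaplacianℕ m

∈-remove : ∀ {A : Set} {x y : A} xs {ys} → y ∈ xs ++ x ∷ ys → y ≢ x → y ∈ xs ++ ys
∈-remove []       (here y≡x) y≢x = contradiction y≡x y≢x
∈-remove []       (there y∈) _   = y∈
∈-remove (_ ∷ xs) (here y≡z) _   = here y≡z
∈-remove (_ ∷ xs) (there y∈) y≢x = there (∈-remove xs y∈ y≢x)

Unique-⊆⇒length≤ : ∀ {A : Set} {xs ys : List A} → Unique xs → All (_∈ ys) xs → length xs ≤ length ys
Unique-⊆⇒length≤ {xs = []}     _            _            = z≤n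
Unique-⊆⇒length≤ {xs = x ∷ xs} (x∉xs ∷ uniq) (x∈ys ∷ xs⊆ys) with ∈-∃++ x∈ys
... | ys₁ , ys₂ , refl = ≤-trans (s≤s (Unique-⊆⇒length≤ uniq xs⊆ys₁ys₂)) (≤-reflexive (begin
  suc (length (ys₁ ++ ys₂))      ≡⟨ cong suc (length-++ ys₁) ⟩
  suc (length ys₁ + length ys₂)  ≡⟨ +-suc (length ys₁) (length ys₂) ⟨
  length ys₁ + length (x ∷ ys₂)  ≡⟨ length-++ ys₁ ⟨
  length (ys₁ ++ x ∷ ys₂)        ∎))
  where
    xs⊆ys₁ys₂ : All (_∈ ys₁ ++ ys₂) xs
    xs⊆ys₁ys₂ = All.tabulate λ y∈xs →
      ∈-remove ys₁ (All.lookup xs⊆ys y∈xs) (All.lookup x∉xs y∈xs ∘ sym)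

module _ {F : List (ℕ × ℕ)} where
  Reach-trans : ∀ {u v w} → Reach F u v → Reach F v w → Reach F u w
  Reach-trans here       r′ = r′
  Reach-trans (step e r) r′ = step e (Reach-trans r r′)

  Reach-sym : ∀ {u v} → Reach F u v → Reach F v u
  Reach-sym here              = here
  Reach-sym (step (inj₁ e) r) = Reach-trans (Reach-sym r) (step (inj₂ e) here)
  Reach-sym (step (inj₂ e) r) = Reach-trans (Reach-sym r) (step (inj₁ e) here)

  Reach-crossing : {P : ℕ → Set} → (∀ y → Dec (P y)) → ∀ {u w} → Reach F u w → P u → ¬ P w →
    ∃ λ e → e ∈ F × ((P (proj₁ e) × ¬ P (proj₂ e)) ⊎ (P (proj₂ e) × ¬ P (proj₁ e)))
  Reach-crossing P? here pu ¬pw = contradiction pu ¬pw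
  Reach-crossing P? (step {u} {w} e r) pu ¬pw with P? w | e
  ... | yes pw  | _      = Reach-crossing P? r pw ¬pw
  ... | no ¬pw′ | inj₁ e = (u , w) , e , inj₁ (pu , ¬pw′)
  ... | no ¬pw′ | inj₂ e = (w , u) , e , inj₂ (pu , ¬pw′)

m<n⊔o⇒m<n⊎m<o : ∀ {m} n o → m < n ⊔ o → m < n ⊎ m < o
m<n⊔o⇒m<n⊎m<o {m} n o m<n⊔o with ≤-total n o
... | inj₁ n≤o = inj₂ (subst (m <_) (m≤n⇒m⊔n≡n n≤o) m<n⊔o)
... | inj₂ o≤n = inj₁ (subst (m <_) (m≥n⇒m⊔n≡m o≤n) m<n⊔o)

prefix-mono : ∀ i {a b} → a ≤ b → prefix i a ≤ prefix i b
prefix-mono i {b = zero}  z≤n = ≤-refl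
prefix-mono i {a} {suc b} a≤1+b with m≤n⇒m<n∨m≡n a≤1+b
... | inj₁ a<1+b = ≤-trans (prefix-mono i (≤-pred a<1+b)) (m≤m+n (prefix i b) (i (suc b)))
... | inj₂ refl  = ≤-refl

spineEdges : ℕ → ℕ → List (ℕ × ℕ)
spineEdges a zero    = []
spineEdges a (suc l) = (a , suc a) ∷ spineEdges (suc a) l

∈-spineEdges⁻ : ∀ {a l e} → e ∈ spineEdges a l → ∃ λ x → a ≤ x × x < a + l × e ≡ (x , suc x)
∈-spineEdges⁻ {a} {suc l} (here refl) = a , ≤-refl , m<m+n a z<s , refl
∈-spineEdges⁻ {a} {suc l} (there e∈) with ∈-spineEdges⁻ e∈
... | x , a<x , x< , refl = x , <⇒≤ a<x , subst (x <_) (sym (+-suc a l)) x< , refl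

∈-spineEdges⁺ : ∀ {a l x} → a ≤ x → x < a + l → (x , suc x) ∈ spineEdges a l
∈-spineEdges⁺ {a} {zero}  a≤x x<a+0 = contradiction (subst (_ <_) (+-identityʳ a) x<a+0) (≤⇒≯ a≤x)
∈-spineEdges⁺ {a} {suc l} {x} a≤x x<   with m≤n⇒m<n∨m≡n a≤x
... | inj₁ a<x  = there (∈-spineEdges⁺ a<x (subst (x <_) (+-suc a l) x<))
... | inj₂ refl = here refl

length-spineEdges : ∀ a l → length (spineEdges a l) ≡ l
length-spineEdges a zero    = refl
length-spineEdges a (suc l) = cong suc (length-spineEdges (suc a) l)

spineEdges-increasing : ∀ a l → AllPairs (λ e e′ → proj₂ e < proj₂ e′) (spineEdges a l)
spineEdges-increasing a zero    = []
spineEdges-increasing a (suc l) = All.tabulate above ∷ spineEdges-increasing (suc a) l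
  where
    above : ∀ {e} → e ∈ spineEdges (suc a) l → suc a < proj₂ e
    above e∈ with ∈-spineEdges⁻ e∈
    ... | x , 1+a≤x , _ , refl = s≤s 1+a≤x

module Caterpillar (n : ℕ) (i : ℕ → ℕ) where

  Pendant : ℕ → ℕ → Set
  Pendant = PendantAt n i

  Adj : ℕ → ℕ → Set
  Adj = CatAdj n i

  base<n : ∀ {t v} → Pendant t v → t < n
  base<n (1≤t , t≤n∸1 , _ , _) =
    ≤-trans (s≤s t≤n∸1) (≤-reflexive (m+[n∸m]≡n (≤-trans 1≤t (≤-trans t≤n∸1 (m∸n≤m n 1)))))

  n<pendant : ∀ {t v} → Pendant t v → n < v
  n<pendant (_ , _ , lo , _) = ≤-<-trans (m≤m+n n _) lo

  pendant<catV : ∀ {t v} → Pendant t v → v < catV n i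
  pendant<catV (_ , t≤n∸1 , _ , hi) = s≤s (≤-trans hi (+-monoʳ-≤ n (prefix-mono i t≤n∸1)))

  spine<catV : ∀ {a} → a ≤ n → a < catV n i
  spine<catV a≤n = s≤s (≤-trans a≤n (m≤m+n n _))

  base<pendant : ∀ {t v} → Pendant t v → t < v
  base<pendant p = <-trans (base<n p) (n<pendant p)

  pendant≤prefix : ∀ {t v x} → Pendant t v → t ≤ x → v ≤ n + prefix i x
  pendant≤prefix (_ , _ , _ , hi) t≤x = ≤-trans hi (+-monoʳ-≤ n (prefix-mono i t≤x))

  prefix<pendant : ∀ {t v x} → Pendant t v → x < t → n + prefix i x < v
  prefix<pendant (_ , _ , lo , _) x<t = ≤-<-trans (+-monoʳ-≤ n (prefix-mono i (∸-monoˡ-≤ 1 x<t))) lo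

  base-unique : ∀ {t t′ v} → Pendant t v → Pendant t′ v → t ≡ t′
  base-unique {t} {t′} p p′ with <-cmp t t′
  ... | tri< t<t′ _ _ = contradiction (proj₂ (proj₂ (proj₂ p))) (<⇒≱ (prefix<pendant p′ t<t′))
  ... | tri≈ _ t≡t′ _ = t≡t′
  ... | tri> _ _ t′<t = contradiction (proj₂ (proj₂ (proj₂ p′))) (<⇒≱ (prefix<pendant p t′<t))

  -- The side of the spine edge (x , suc x) that contains 0.
  Left : ℕ → ℕ → Set
  Left x y = y ≤ x ⊎ (n < y × y ≤ n + prefix i x)

  Left? : ∀ x y → Dec (Left x y)
  Left? x y = (y ≤? x) ⊎-dec ((n <? y) ×-dec (y ≤? n + prefix i x))

  Left-spine⁻ : ∀ {x y} → y ≤ n → Left x y → y ≤ x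
  Left-spine⁻ y≤n (inj₁ y≤x)      = y≤x
  Left-spine⁻ y≤n (inj₂ (n<y , _)) = contradiction y≤n (<⇒≱ n<y)

  Left-pendant⁺ : ∀ {x t v} → Pendant t v → t ≤ x → Left x v
  Left-pendant⁺ p t≤x = inj₂ (n<pendant p , pendant≤prefix p t≤x)

  Left-pendant⁻ : ∀ {x t v} → x < n → Pendant t v → Left x v → t ≤ x
  Left-pendant⁻ x<n p (inj₁ v≤x)       = contradiction v≤x (<⇒≱ (<-trans x<n (n<pendant p)))
  Left-pendant⁻ {x} {t} x<n p (inj₂ (_ , v≤)) with t ≤? x
  ... | yes t≤x = t≤x
  ... | no  t≰x = contradiction v≤ (<⇒≱ (prefix<pendant p (≰⇒> t≰x)))

  spine-¬Left : ∀ {x a} → a ≤ n → x < a → ¬ Left x a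
  spine-¬Left a≤n x<a = <⇒≱ x<a ∘ Left-spine⁻ a≤n

  pendant-¬Left : ∀ {x t v} → Pendant t v → x < t → ¬ Left x v
  pendant-¬Left p x<t = <⇒≱ x<t ∘ Left-pendant⁻ (<-trans x<t (base<n p)) p

  Left-crossing : ∀ {x a b} → x < n → a < b → Adj a b →
    (Left x a × ¬ Left x b) ⊎ (Left x b × ¬ Left x a) → (a , b) ≡ (x , suc x)
  Left-crossing x<n a<b (inj₁ (inj₁ (refl , b≤n))) (inj₁ (la , ¬lb)) =
    cong (λ z → z , suc z) (≤-antisym (Left-spine⁻ (<⇒≤ b≤n) la) (≮⇒≥ (¬lb ∘ inj₁)))
  Left-crossing x<n a<b (inj₁ (inj₁ (refl , b≤n))) (inj₂ (lb , ¬la)) =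
    contradiction (inj₁ (<⇒≤ (Left-spine⁻ b≤n lb))) ¬la
  Left-crossing x<n a<b (inj₁ (inj₂ p)) (inj₁ (la , ¬lb)) =
    contradiction (Left-pendant⁺ p (Left-spine⁻ (<⇒≤ (base<n p)) la)) ¬lb
  Left-crossing x<n a<b (inj₁ (inj₂ p)) (inj₂ (lb , ¬la)) =
    contradiction (inj₁ (Left-pendant⁻ x<n p lb)) ¬la
  Left-crossing x<n a<b (inj₂ (inj₁ (refl , _))) _ = contradiction a<b (<-asym (n<1+n _))
  Left-crossing x<n a<b (inj₂ (inj₂ p))          _ = contradiction a<b (<-asym (base<pendant p))

  pendant-crossing : ∀ {t v a b} → Pendant t v → a < b → Adj a b →
    (a ≡ v × b ≢ v) ⊎ (b ≡ v × a ≢ v) → (a , b) ≡ (t , v)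
  pendant-crossing p a<b (inj₁ (inj₁ (refl , b≤n))) (inj₁ (refl , _)) =
    contradiction (<⇒≤ b≤n) (<⇒≱ (n<pendant p))
  pendant-crossing p a<b (inj₁ (inj₁ (refl , b≤n))) (inj₂ (refl , _)) =
    contradiction b≤n (<⇒≱ (n<pendant p))
  pendant-crossing p a<b (inj₁ (inj₂ q)) (inj₁ (refl , _)) = contradiction (base<n q) (<-asym (n<pendant p))
  pendant-crossing p a<b (inj₁ (inj₂ q)) (inj₂ (refl , _)) = cong (_, _) (base-unique q p)
  pendant-crossing p a<b (inj₂ (inj₁ (refl , _))) _ = contradiction a<b (<-asym (n<1+n _))
  pendant-crossing p a<b (inj₂ (inj₂ q))          _ = contradiction a<b (<-asym (base<pendant q))

  module _ (H : Subgraph (catV n i) Adj) where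
    open Subgraph H

    spine-edge-required : ∀ {x u w} → x < n → Reach edges u w → Left x u → ¬ Left x w →
                          (x , suc x) ∈ edges
    spine-edge-required x<n r lu ¬lw with Reach-crossing (Left? _) r lu ¬lw
    ... | e , e∈ , crosses with edgeOK e∈
    ... | a<b , adj , _ = subst (_∈ edges) (Left-crossing x<n a<b adj crosses) e∈

    pendant-edge-required : ∀ {t v w} → Pendant t v → Reach edges v w → w ≢ v → (t , v) ∈ edges
    pendant-edge-required p r w≢v with Reach-crossing (_≟ _) r refl w≢v
    ... | e , e∈ , crosses with edgeOK e∈
    ... | a<b , adj , _ = subst (_∈ edges) (pendant-crossing p a<b adj crosses) e∈

  PendantEdge : ℕ → ℕ × ℕ → Set
  PendantEdge m (t , v) = Pendant t v × t ≤ m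

  DistinctPendants : List (ℕ × ℕ) → Set
  DistinctPendants = AllPairs (λ e e′ → proj₂ e ≢ proj₂ e′)

  module SpineTree (m : ℕ) (m≤n : m ≤ n) (P : List (ℕ × ℕ))
                   (P-pendant : All (PendantEdge m) P) (P-distinct : DistinctPendants P) where

    edges : List (ℕ × ℕ)
    edges = spineEdges 0 m ++ P

    verts : List ℕ
    verts = upTo (suc m) ++ map proj₂ P

    verts<catV : All (_< catV n i) verts
    verts<catV = All.tabulate bound
      where
        bound : ∀ {y} → y ∈ verts → y < catV n i
        bound y∈ with ∈-++⁻ (upTo (suc m)) y∈
        ... | inj₁ y∈spine = spine<catV (≤-trans (≤-pred (∈-upTo⁻ y∈spine)) m≤n)
        ... | inj₂ y∈P with ∈-map⁻ proj₂ y∈P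
        ...   | e , e∈ , refl = pendant<catV (proj₁ (All.lookup P-pendant e∈))

    edges-unique : Unique edges
    edges-unique = AllPairs.map (λ ends≢ e≡e′ → ends≢ (cong proj₂ e≡e′))
      (AllPairs.++⁺ (AllPairs.map <⇒≢ (spineEdges-increasing 0 m)) P-distinct
        (All.tabulate λ e∈ → All.tabulate λ e′∈ → spine≢pendant e∈ e′∈))
      where
        spine≢pendant : ∀ {e e′} → e ∈ spineEdges 0 m → e′ ∈ P → proj₂ e ≢ proj₂ e′
        spine≢pendant e∈ e′∈ with ∈-spineEdges⁻ e∈
        ... | x , _ , x<m , refl =
          <⇒≢ (≤-<-trans (≤-trans x<m m≤n) (n<pendant (proj₁ (All.lookup P-pendant e′∈))))

    edges-ok : ∀ {u v} → (u , v) ∈ edges → u < v × Adj u v × u ∈ verts × v ∈ verts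
    edges-ok e∈ with ∈-++⁻ (spineEdges 0 m) e∈
    ... | inj₁ e∈spine with ∈-spineEdges⁻ e∈spine
    ...   | x , _ , x<m , refl = n<1+n x , inj₁ (inj₁ (refl , ≤-trans x<m m≤n)) ,
            ∈-++⁺ˡ (∈-upTo⁺ (≤-trans x<m (n≤1+n m))) , ∈-++⁺ˡ (∈-upTo⁺ (s≤s x<m))
    edges-ok e∈ | inj₂ e∈P with All.lookup P-pendant e∈P
    ...   | p , t≤m = base<pendant p , inj₁ (inj₂ p) ,
            ∈-++⁺ˡ (∈-upTo⁺ (s≤s t≤m)) , ∈-++⁺ʳ _ (∈-map⁺ proj₂ e∈P)

    tree : Subgraph (catV n i) Adj
    tree = record { verts = verts ; edges = edges ; verts<V = verts<catV
                  ; edgesUniq = edges-unique ; edgeOK = edges-ok }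

    reach-spine : ∀ y → y ≤ m → Reach edges 0 y
    reach-spine zero    _     = here
    reach-spine (suc y) 1+y≤m =
      Reach-trans (reach-spine y (<⇒≤ 1+y≤m)) (step (inj₁ (∈-++⁺ˡ (∈-spineEdges⁺ z≤n 1+y≤m))) here)

    reach-from-0 : ∀ {y} → y ∈ verts → Reach edges 0 y
    reach-from-0 {y} y∈ with ∈-++⁻ (upTo (suc m)) y∈
    ... | inj₁ y∈spine = reach-spine y (≤-pred (∈-upTo⁻ y∈spine))
    ... | inj₂ y∈P with ∈-map⁻ proj₂ y∈P
    ...   | e , e∈ , refl = Reach-trans (reach-spine (proj₁ e) (proj₂ (All.lookup P-pendant e∈)))
                                        (step (inj₁ (∈-++⁺ʳ _ e∈)) here)

    tree-connected : Connected tree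
    tree-connected u∈ v∈ = Reach-trans (Reach-sym (reach-from-0 u∈)) (reach-from-0 v∈)

    length-edges : length edges ≡ m + length P
    length-edges = trans (length-++ (spineEdges 0 m)) (cong (_+ length P) (length-spineEdges 0 m))

  -- The spine path 0 … m together with P is a connected subgraph containing Y, and by a
  -- cut argument each of its edges lies in every connected subgraph containing Y.
  steiner-distance : ∀ m (P : List (ℕ × ℕ)) (Y : List ℕ) {d} → m ≤ n →
    All (PendantEdge m) P → DistinctPendants P →
    0 ∈ Y → All (λ e → proj₂ e ∈ Y) P → (∀ {y} → y ∈ Y → y ≤ m ⊎ y ∈ map proj₂ P) →
    (∀ x → x < m → ∃ λ w → w ∈ Y × ¬ Left x w) →
    IsSteinerDistance (catV n i) Adj Y d → d ≡ m + length P
  steiner-distance m P Y {d} m≤n P-pendant P-distinct 0∈Y P⊆Y Y⊆tree beyond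
                   ((H , (conn , Y⊆H) , size≡d) , minimal) = ≤-antisym upper lower
    where
      open SpineTree m m≤n P P-pendant P-distinct

      Y⊆verts : ∀ {y} → y ∈ Y → y ∈ verts
      Y⊆verts y∈ with Y⊆tree y∈
      ... | inj₁ y≤m = ∈-++⁺ˡ (∈-upTo⁺ (s≤s y≤m))
      ... | inj₂ y∈P = ∈-++⁺ʳ _ y∈P

      spine⊆H : ∀ {e} → e ∈ spineEdges 0 m → e ∈ Subgraph.edges H
      spine⊆H e∈ with ∈-spineEdges⁻ e∈
      ... | x , _ , x<m , refl with beyond x x<m
      ...   | w , w∈Y , ¬lw =
        spine-edge-required H (≤-trans x<m m≤n) (conn (Y⊆H 0∈Y) (Y⊆H w∈Y)) (inj₁ z≤n) ¬lw

      P⊆H : ∀ {e} → e ∈ P → e ∈ Subgraph.edges H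
      P⊆H e∈ with All.lookup P-pendant e∈
      ... | p , _ = pendant-edge-required H p (conn (Y⊆H (All.lookup P⊆Y e∈)) (Y⊆H 0∈Y))
                                              (<⇒≢ (≤-<-trans z≤n (n<pendant p)))

      upper : d ≤ m + length P
      upper = ≤-trans (minimal tree (tree-connected , Y⊆verts)) (≤-reflexive length-edges)

      lower : m + length P ≤ d
      lower = subst₂ _≤_ length-edges size≡d
                (Unique-⊆⇒length≤ edges-unique (All.++⁺ (All.tabulate spine⊆H) (All.tabulate P⊆H)))

  block-of : ∀ T k → k < prefix i T → ∃ λ t → 1 ≤ t × t ≤ T × prefix i (t ∸ 1) ≤ k × k < prefix i t
  block-of zero    k ()
  block-of (suc T) k k<prefix with k <? prefix i T
  ... | yes k<  with block-of T k k<
  ...   | t , 1≤t , t≤T , lo , hi = t , 1≤t , m≤n⇒m≤1+n t≤T , lo , hi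
  block-of (suc T) k k<prefix | no k≮ = suc T , s≤s z≤n , ≤-refl , ≮⇒≥ k≮ , k<prefix

  pendant-base : ∀ k → k < numPendants n i → ∃ λ t → Pendant t (n + suc k)
  pendant-base k k<s with block-of (n ∸ 1) k k<s
  ... | t , 1≤t , t≤ , lo , hi = t , 1≤t , t≤ , +-monoʳ-< n (s≤s lo) , +-monoʳ-≤ n hi

  module SteinerValues (sd : List ℕ → ℕ)
                       (sd-steiner : ∀ Y → All (_< catV n i) Y → IsSteinerDistance (catV n i) Adj Y (sd Y)) where

    sd-twoPendants : ∀ {t t′ v w} → Pendant t v → Pendant t′ w → v ≢ w →
                     sd (0 ∷ v ∷ 0 ∷ w ∷ []) ≡ (t ⊔ t′) + 2
    sd-twoPendants {t} {t′} {v} {w} p q v≢w =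
      steiner-distance (t ⊔ t′) ((t , v) ∷ (t′ , w) ∷ []) _
        (⊔-lub (<⇒≤ (base<n p)) (<⇒≤ (base<n q)))
        ((p , m≤m⊔n t t′) ∷ (q , m≤n⊔m t t′) ∷ []) ((v≢w ∷ []) ∷ [] ∷ [])
        (here refl) (there (here refl) ∷ there (there (there (here refl))) ∷ [])
        within beyond
        (sd-steiner _ (s≤s z≤n ∷ pendant<catV p ∷ s≤s z≤n ∷ pendant<catV q ∷ []))
      where
        within : ∀ {y} → y ∈ 0 ∷ v ∷ 0 ∷ w ∷ [] → y ≤ t ⊔ t′ ⊎ y ∈ v ∷ w ∷ []
        within (here refl)                         = inj₁ z≤n
        within (there (here refl))                 = inj₂ (here refl)
        within (there (there (here refl)))         = inj₁ z≤n
        within (there (there (there (here refl)))) = inj₂ (there (here refl))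
        beyond : ∀ x → x < t ⊔ t′ → ∃ λ y → y ∈ 0 ∷ v ∷ 0 ∷ w ∷ [] × ¬ Left x y
        beyond x x< with m<n⊔o⇒m<n⊎m<o t t′ x<
        ... | inj₁ x<t  = v , there (here refl) , pendant-¬Left p x<t
        ... | inj₂ x<t′ = w , there (there (there (here refl))) , pendant-¬Left q x<t′

    sd-onePendant : ∀ {t v} → Pendant t v → sd (0 ∷ v ∷ 0 ∷ v ∷ []) ≡ t + 1
    sd-onePendant {t} {v} p =
      steiner-distance t ((t , v) ∷ []) _ (<⇒≤ (base<n p)) ((p , ≤-refl) ∷ []) ([] ∷ [])
        (here refl) (there (here refl) ∷ []) within beyond
        (sd-steiner _ (s≤s z≤n ∷ pendant<catV p ∷ s≤s z≤n ∷ pendant<catV p ∷ []))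
      where
        within : ∀ {y} → y ∈ 0 ∷ v ∷ 0 ∷ v ∷ [] → y ≤ t ⊎ y ∈ v ∷ []
        within (here refl)                         = inj₁ z≤n
        within (there (here refl))                 = inj₂ (here refl)
        within (there (there (here refl)))         = inj₁ z≤n
        within (there (there (there (here refl)))) = inj₂ (here refl)
        beyond : ∀ x → x < t → ∃ λ y → y ∈ 0 ∷ v ∷ 0 ∷ v ∷ [] × ¬ Left x y
        beyond x x<t = v , there (here refl) , pendant-¬Left p x<t

    sd-spinePendant : ∀ {t v a} → Pendant t v → a ≤ n → sd (0 ∷ a ∷ 0 ∷ v ∷ []) ≡ (a ⊔ t) + 1
    sd-spinePendant {t} {v} {a} p a≤n =
      steiner-distance (a ⊔ t) ((t , v) ∷ []) _ (⊔-lub a≤n (<⇒≤ (base<n p)))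
        ((p , m≤n⊔m a t) ∷ []) ([] ∷ [])
        (here refl) (there (there (there (here refl))) ∷ []) within beyond
        (sd-steiner _ (s≤s z≤n ∷ spine<catV a≤n ∷ s≤s z≤n ∷ pendant<catV p ∷ []))
      where
        within : ∀ {y} → y ∈ 0 ∷ a ∷ 0 ∷ v ∷ [] → y ≤ a ⊔ t ⊎ y ∈ v ∷ []
        within (here refl)                         = inj₁ z≤n
        within (there (here refl))                 = inj₁ (m≤m⊔n a t)
        within (there (there (here refl)))         = inj₁ z≤n
        within (there (there (there (here refl)))) = inj₂ (here refl)
        beyond : ∀ x → x < a ⊔ t → ∃ λ y → y ∈ 0 ∷ a ∷ 0 ∷ v ∷ [] × ¬ Left x y
        beyond x x< with m<n⊔o⇒m<n⊎m<o a t x<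
        ... | inj₁ x<a = a , there (here refl) , spine-¬Left a≤n x<a
        ... | inj₂ x<t = v , there (there (there (here refl))) , pendant-¬Left p x<t

    sd-endPendant : ∀ {t v b} → Pendant t v → b ≤ n → sd (b ∷ n ∷ 0 ∷ v ∷ []) ≡ n + 1
    sd-endPendant {t} {v} {b} p b≤n =
      steiner-distance n ((t , v) ∷ []) _ ≤-refl ((p , <⇒≤ (base<n p)) ∷ []) ([] ∷ [])
        (there (there (here refl))) (there (there (there (here refl))) ∷ []) within beyond
        (sd-steiner _ (spine<catV b≤n ∷ spine<catV ≤-refl ∷ s≤s z≤n ∷ pendant<catV p ∷ []))
      where
        within : ∀ {y} → y ∈ b ∷ n ∷ 0 ∷ v ∷ [] → y ≤ n ⊎ y ∈ v ∷ []
        within (here refl)                         = inj₁ b≤n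
        within (there (here refl))                 = inj₁ ≤-refl
        within (there (there (here refl)))         = inj₁ z≤n
        within (there (there (there (here refl)))) = inj₂ (here refl)
        beyond : ∀ x → x < n → ∃ λ y → y ∈ b ∷ n ∷ 0 ∷ v ∷ [] × ¬ Left x y
        beyond x x<n = n , there (here refl) , spine-¬Left ≤-refl x<n

module Column (n : ℕ) where

  height : ℕ → ℕ → ℕ
  height t j = (j ⊓ n) ⊔ t

  -- Row r of M is {0 , r + 1} for r < n and {r + 1 - n , n} otherwise; together with a
  -- pendant at t, its Steiner tree is the spine up to height t (suc r) plus the pendant edge.
  column : ℕ → ℕ → ℤ
  column t r = + (height t (suc r) + 1)

  height-step : ∀ t j → t ≤ j → j < n → height t (suc j) ≡ suc (height t j)
  height-step t j t≤j j<n = begin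
    (suc j ⊓ n) ⊔ t  ≡⟨ cong (_⊔ t) (m≤n⇒m⊓n≡m j<n) ⟩
    suc j ⊔ t        ≡⟨ m≥n⇒m⊔n≡m (m≤n⇒m≤1+n t≤j) ⟩
    suc j            ≡⟨ cong suc (m≥n⇒m⊔n≡m t≤j) ⟨
    suc (j ⊔ t)      ≡⟨ cong (λ z → suc (z ⊔ t)) (m≤n⇒m⊓n≡m (<⇒≤ j<n)) ⟨
    suc ((j ⊓ n) ⊔ t) ∎

  height-flat : ∀ t j → ¬ (t ≤ j × j < n) → height t (suc j) ≡ height t j
  height-flat t j outside with j <? n
  ... | yes j<n = begin
    (suc j ⊓ n) ⊔ t  ≡⟨ cong (_⊔ t) (m≤n⇒m⊓n≡m j<n) ⟩
    suc j ⊔ t        ≡⟨ m≤n⇒m⊔n≡n j<t ⟩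
    t                ≡⟨ m≤n⇒m⊔n≡n (<⇒≤ j<t) ⟨
    j ⊔ t            ≡⟨ cong (_⊔ t) (m≤n⇒m⊓n≡m (<⇒≤ j<n)) ⟨
    (j ⊓ n) ⊔ t      ∎
    where
      j<t : j < t
      j<t = ≰⇒> (λ t≤j → outside (t≤j , j<n))
  ... | no j≮n = cong (_⊔ t) (trans (m≥n⇒m⊓n≡n (m≤n⇒m≤1+n n≤j)) (sym (m≥n⇒m⊓n≡n n≤j)))
    where
      n≤j : n ≤ j
      n≤j = ≮⇒≥ j≮n

  Δ-column : ∀ t c → Δ (column t) c ≡ 𝟙 (t ≤? suc c ×-dec suc c <? n)
  Δ-column t c = by-cases (t ≤? suc c ×-dec suc c <? n)
    where
      h : ℕ
      h = height t (suc c)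
      cancel : ∀ z → 1ℤ +ℤ z - z ≡ 1ℤ
      cancel = solve-∀
      by-cases : (d : Dec (t ≤ suc c × suc c < n)) → Δ (column t) c ≡ 𝟙 d
      by-cases (yes (t≤ , <n)) = begin
        + (height t (suc (suc c)) + 1) - + (h + 1)
          ≡⟨ cong (λ h′ → + (h′ + 1) - + (h + 1)) (height-step t (suc c) t≤ <n) ⟩
        1ℤ +ℤ + (h + 1) - + (h + 1)                 ≡⟨ cancel (+ (h + 1)) ⟩
        1ℤ                                          ∎
      by-cases (no outside) = begin
        + (height t (suc (suc c)) + 1) - + (h + 1)
          ≡⟨ cong (λ h′ → + (h′ + 1) - + (h + 1)) (height-flat t (suc c) outside) ⟩
        + (h + 1) - + (h + 1)                       ≡⟨ ℤ.+-inverseʳ (+ (h + 1)) ⟩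
        0ℤ                                          ∎

  Δ-column-⊔ : ∀ t t′ c → Δ (column t) c * Δ (column t′) c ≡ Δ (column (t ⊔ t′)) c
  Δ-column-⊔ t t′ c = begin
    Δ (column t) c * Δ (column t′) c  ≡⟨ cong₂ _*_ (Δ-column t c) (Δ-column t′ c) ⟩
    𝟙 (rise t) * 𝟙 (rise t′)          ≡⟨ 𝟙-× (rise t) (rise t′) ⟨
    𝟙 (rise t ×-dec rise t′)          ≡⟨ 𝟙-cong (rise t ×-dec rise t′) (rise (t ⊔ t′)) both⇒⊔ ⊔⇒both ⟩
    𝟙 (rise (t ⊔ t′))                 ≡⟨ Δ-column (t ⊔ t′) c ⟨
    Δ (column (t ⊔ t′)) c             ∎
    where
      j : ℕ
      j = suc c
      rise : ∀ t → Dec (t ≤ j × j < n)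
      rise t = t ≤? j ×-dec j <? n
      both⇒⊔ : (t ≤ j × j < n) × (t′ ≤ j × j < n) → t ⊔ t′ ≤ j × j < n
      both⇒⊔ ((t≤j , j<n) , (t′≤j , _)) = ⊔-lub t≤j t′≤j , j<n
      ⊔⇒both : t ⊔ t′ ≤ j × j < n → (t ≤ j × j < n) × (t′ ≤ j × j < n)
      ⊔⇒both (⊔≤j , j<n) = (≤-trans (m≤m⊔n t t′) ⊔≤j , j<n) , (≤-trans (m≤n⊔m t t′) ⊔≤j , j<n)

  column-top : ∀ t r → t ≤ n → n ≤ suc r → column t r ≡ + (n + 1)
  column-top t r t≤n n≤1+r =
    cong (λ h → + (h + 1)) (trans (cong (_⊔ t) (m≥n⇒m⊓n≡n n≤1+r)) (m≥n⇒m⊔n≡m t≤n))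

  column-bottom : ∀ t → 1 ≤ t → column t 0 ≡ + (t + 1)
  column-bottom t 1≤t = cong (λ h → + (h + 1)) (m≤n⇒m⊔n≡n (≤-trans (m⊓n≤m 1 n) 1≤t))

module Entries (n : ℕ) (i : ℕ → ℕ) (sd : List ℕ → ℕ)
  (sd-steiner : ∀ Y → All (_< catV n i) Y → IsSteinerDistance (catV n i) (CatAdj n i) Y (sd Y)) where
  open Caterpillar n i
  open SteinerValues sd sd-steiner
  open Column n

  m s : ℕ
  m = n + (n ∸ 1)
  s = numPendants n i

  M : Matrix m s
  M = matM n i sd

  N : Matrix s s
  N = matN n i sd

  L : Matrix m m
  L = pathLaplacian m

  base : Fin s → ℕ
  base k = proj₁ (pendant-base (toℕ k) (toℕ<n k))

  base-pendant : ∀ k → Pendant (base k) (n + suc (toℕ k))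
  base-pendant k = proj₂ (pendant-base (toℕ k) (toℕ<n k))

  M≡column : ∀ r k → M r k ≡ column (base k) (toℕ r)
  M≡column r k with toℕ r <? n
  ... | yes r<n = cong +_ (begin
    sd (0 ∷ suc (toℕ r) ∷ colSet n k)  ≡⟨ sd-spinePendant (base-pendant k) r<n ⟩
    (suc (toℕ r) ⊔ base k) + 1        ≡⟨ cong (λ a → (a ⊔ base k) + 1) (m≤n⇒m⊓n≡m r<n) ⟨
    height (base k) (suc (toℕ r)) + 1  ∎)
  ... | no r≮n = begin
    + sd (suc (toℕ r ∸ n) ∷ n ∷ colSet n k)
      ≡⟨ cong +_ (sd-endPendant (base-pendant k) 1+r∸n≤n) ⟩
    + (n + 1)
      ≡⟨ column-top (base k) (toℕ r) (<⇒≤ (base<n (base-pendant k))) (m≤n⇒m≤1+n n≤r) ⟨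
    column (base k) (toℕ r)
      ∎
    where
      n≤r : n ≤ toℕ r
      n≤r = ≮⇒≥ r≮n
      1+r∸n≤n : suc (toℕ r ∸ n) ≤ n
      1+r∸n≤n = ≤-trans (subst (toℕ r ∸ n <_) (m+n∸m≡n n (n ∸ 1)) (∸-monoˡ-< (toℕ<n r) n≤r)) (m∸n≤m n 1)

  M′LM : ∀ k l → ((transpose M ⊗ L) ⊗ M) k l ≡ + (n + 1) - + (base k ⊔ base l + 1)
  M′LM k l = begin
    ((transpose M ⊗ L) ⊗ M) k l
      ≡⟨ pathLaplacian-gram m M (column ∘ base) M≡column k l ⟩
    ∑ (pred m) (λ c → Δ (column (base k)) c * Δ (column (base l)) c)
      ≡⟨ ∑-cong (pred m) (λ {c} _ → Δ-column-⊔ (base k) (base l) c) ⟩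
    ∑ (pred m) (Δ (column t))
      ≡⟨ ∑-Δ (pred m) (column t) ⟩
    column t (pred m) - column t 0
      ≡⟨ cong₂ _-_ (column-top t (pred m) (<⇒≤ t<n) n≤1+pred[m]) (column-bottom t 1≤t) ⟩
    + (n + 1) - + (t + 1)
      ∎
    where
      t : ℕ
      t = base k ⊔ base l
      t<n : t < n
      t<n = ⊔-lub (base<n (base-pendant k)) (base<n (base-pendant l))
      1≤t : 1 ≤ t
      1≤t = ≤-trans (proj₁ (base-pendant k)) (m≤m⊔n (base k) (base l))
      n≤m : n ≤ m
      n≤m = m≤m+n n (n ∸ 1)
      0<m : 0 < m
      0<m = <-≤-trans (≤-<-trans z≤n t<n) n≤m
      n≤1+pred[m] : n ≤ suc (pred m)
      n≤1+pred[m] = ≤-trans n≤m (≤-reflexive (sym (suc-pred m {{>-nonZero 0<m}})))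

  entry-diagonal : ∀ k → (N ⊕ ((transpose M ⊗ L) ⊗ M)) k k ≡ + (n + 2) * 1ℤ - 1ℤ
  entry-diagonal k = begin
    N k k +ℤ ((transpose M ⊗ L) ⊗ M) k k
      ≡⟨ cong₂ _+ℤ_ (cong +_ (sd-onePendant (base-pendant k))) (M′LM k k) ⟩
    + (t + 1) +ℤ (+ (n + 1) - + (t ⊔ t + 1))
      ≡⟨ cong (λ a → + (t + 1) +ℤ (+ (n + 1) - + (a + 1))) (⊔-idem t) ⟩
    + (t + 1) +ℤ (+ (n + 1) - + (t + 1))
      ≡⟨ cancel (+ t) (+ n) ⟩
    + (n + 2) * 1ℤ - 1ℤ
      ∎
    where
      t : ℕ
      t = base k
      cancel : ∀ a b → a +ℤ 1ℤ +ℤ (b +ℤ 1ℤ - (a +ℤ 1ℤ)) ≡ (b +ℤ + 2) * 1ℤ - 1ℤ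
      cancel = solve-∀

  entry-offDiagonal : ∀ k l → k ≢ l → (N ⊕ ((transpose M ⊗ L) ⊗ M)) k l ≡ + (n + 2) * 1ℤ - 0ℤ
  entry-offDiagonal k l k≢l = begin
    N k l +ℤ ((transpose M ⊗ L) ⊗ M) k l
      ≡⟨ cong₂ _+ℤ_ (cong +_ (sd-twoPendants (base-pendant k) (base-pendant l) v≢w)) (M′LM k l) ⟩
    + (t + 2) +ℤ (+ (n + 1) - + (t + 1))
      ≡⟨ cancel (+ t) (+ n) ⟩
    + (n + 2) * 1ℤ - 0ℤ
      ∎
    where
      t : ℕ
      t = base k ⊔ base l
      v≢w : n + suc (toℕ k) ≢ n + suc (toℕ l)
      v≢w = k≢l ∘ toℕ-injective ∘ suc-injective ∘ +-cancelˡ-≡ n _ _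
      cancel : ∀ a b → a +ℤ + 2 +ℤ (b +ℤ 1ℤ - (a +ℤ 1ℤ)) ≡ (b +ℤ + 2) * 1ℤ - 0ℤ
      cancel = solve-∀

mainTheorem6 : (n : ℕ) → 1 ≤ n → (i : ℕ → ℕ) → (sd : List ℕ → ℕ) →
    (∀ (Y : List ℕ) → All (_< catV n i) Y → IsSteinerDistance (catV n i) (CatAdj n i) Y (sd Y)) →
    ∀ k l →
      (matN n i sd ⊕ ((transpose (matM n i sd) ⊗ pathLaplacian (n + (n ∸ 1))) ⊗ matM n i sd)) k l
        ≡ (+ (n + 2)) * Jₘ (numPendants n i) k l - Iₘ (numPendants n i) k l
mainTheorem6 n _ i sd sd-steiner k l with k Fin.≟ l
... | yes refl = Entries.entry-diagonal n i sd sd-steiner k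
... | no k≢l   = Entries.entry-offDiagonal n i sd sd-steiner k l k≢l
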